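{- Let $I$ be the graph consisting of two disjoint copies of the complete graph $K_4$ together with one additional edge joining a vertex of the first copy to a vertex of the second copy. Then $\chi_{td}(I)=8$, $I$ is connected, $I$ has order $8=\chi_{td}(I)$, and $I$ is not saturable.
   Context: For a finite graph $G$ and a positive integer $k$, a proper $k$-total difference labeling (TDL) of $G$ is a function $f$ from $V(G)\cup E(G)$ to $\{1,2,\dots,k\}$ such that: (1) for every edge $\{u,v\}$, $f(\{u,v\})=|f(u)-f(v)|$; (2) adjacent vertices receive different labels; (3) two edges sharing a vertex receive different labels; (4) no edge receives the same label as one of its endpoints. $\chi_{td}(G)$ denotes the smallest $k$ for which $G$ has a proper $k$-TDL. If $G$ has order $n$, a TDL of $G$ is saturated if $\chi_{td}(G)=n$ and the set of vertex labels used is exactly $\{1,2,\dots,\chi_{td}(G)\}$. A graph is saturable if it has at least one saturated labeling. -}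

module Defs where

open import Data.Nat using (ℕ; zero; suc; _≤_; _<_; _≡ᵇ_; _<ᵇ_)
open import Data.Nat.Base using (∣_-_∣)
open import Data.Fin using (Fin; toℕ; zero; suc)
open import Data.Bool using (Bool; true; false; _∧_; _∨_; not; T)
open import Data.Product using (Σ; _×_; ∃)
open import Relation.Nullary using (¬_)
open import Relation.Binary.PropositionalEquality using (_≡_; _≢_)
open import Relation.Binary.Construct.Closure.ReflexiveTransitive using (Star)

record Graph (n : ℕ) : Set₁ where
  field
    Adj   : Fin n → Fin n → Set
    sym   : ∀ {u v} → Adj u v → Adj v u
    irref : ∀ {u} → ¬ Adj u u
open Graph public

order : ∀ {n} → Graph n → ℕ
order {n} _ = n

-- A proper k-total difference labeling, given by its vertex labels f;
-- the edge label of {u,v} is |f u - f v| (condition (1)).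
record IsTDL {n : ℕ} (G : Graph n) (k : ℕ) (f : Fin n → ℕ) : Set where
  field
    vlabel-range : ∀ v → 1 ≤ f v × f v ≤ k
    elabel-range : ∀ u v → Adj G u v → 1 ≤ ∣ f u - f v ∣ × ∣ f u - f v ∣ ≤ k
    vproper : ∀ u v → Adj G u v → f u ≢ f v
    eproper : ∀ u v w → Adj G u v → Adj G u w → v ≢ w → ∣ f u - f v ∣ ≢ ∣ f u - f w ∣
    veproper : ∀ u v → Adj G u v → ∣ f u - f v ∣ ≢ f u

HasTDL : ∀ {n} → Graph n → ℕ → Set
HasTDL {n} G k = Σ (Fin n → ℕ) (IsTDL G k)

χtd≡ : ∀ {n} → Graph n → ℕ → Set
χtd≡ G k = HasTDL G k × (∀ j → j < k → ¬ HasTDL G j)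

IsSaturated : ∀ {n} → Graph n → (Fin n → ℕ) → Set
IsSaturated {n} G f =
  χtd≡ G n × IsTDL G n f × (∀ m → 1 ≤ m → m ≤ n → ∃ λ v → f v ≡ m)

Saturable : ∀ {n} → Graph n → Set
Saturable {n} G = ∃ λ (f : Fin n → ℕ) → IsSaturated G f

Connected : ∀ {n} → Graph n → Set
Connected {n} G = ∀ (u v : Fin n) → Star (Adj G) u v

-- The graph I: vertices 0..3 form a K4, vertices 4..7 form a K4,
-- plus the edge {0,4}.
adjI : Fin 8 → Fin 8 → Bool
adjI i j =
  not (toℕ i ≡ᵇ toℕ j) ∧
  ( (sameBlock) ∨ ((toℕ i ≡ᵇ 0) ∧ (toℕ j ≡ᵇ 4)) ∨ ((toℕ i ≡ᵇ 4) ∧ (toℕ j ≡ᵇ 0)) )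
  where
  sameBlock : Bool
  sameBlock with toℕ i <ᵇ 4 | toℕ j <ᵇ 4
  ... | true  | true  = true
  ... | false | false = true
  ... | _     | _     = false

adjI-sym : ∀ u v → T (adjI u v) → T (adjI v u)
adjI-sym zero zero p = p
adjI-sym zero (suc zero) p = p
adjI-sym zero (suc (suc zero)) p = p
adjI-sym zero (suc (suc (suc zero))) p = p
adjI-sym zero (suc (suc (suc (suc zero)))) p = p
adjI-sym zero (suc (suc (suc (suc (suc zero))))) p = p
adjI-sym zero (suc (suc (suc (suc (suc (suc zero)))))) p = p
adjI-sym zero (suc (suc (suc (suc (suc (suc (suc zero))))))) p = p
adjI-sym (suc zero) zero p = p
adjI-sym (suc zero) (suc zero) p = p
adjI-sym (suc zero) (suc (suc zero)) p = p
adjI-sym (suc zero) (suc (suc (suc zero))) p = p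
adjI-sym (suc zero) (suc (suc (suc (suc zero)))) p = p
adjI-sym (suc zero) (suc (suc (suc (suc (suc zero))))) p = p
adjI-sym (suc zero) (suc (suc (suc (suc (suc (suc zero)))))) p = p
adjI-sym (suc zero) (suc (suc (suc (suc (suc (suc (suc zero))))))) p = p
adjI-sym (suc (suc zero)) zero p = p
adjI-sym (suc (suc zero)) (suc zero) p = p
adjI-sym (suc (suc zero)) (suc (suc zero)) p = p
adjI-sym (suc (suc zero)) (suc (suc (suc zero))) p = p
adjI-sym (suc (suc zero)) (suc (suc (suc (suc zero)))) p = p
adjI-sym (suc (suc zero)) (suc (suc (suc (suc (suc zero))))) p = p
adjI-sym (suc (suc zero)) (suc (suc (suc (suc (suc (suc zero)))))) p = p
adjI-sym (suc (suc zero)) (suc (suc (suc (suc (suc (suc (suc zero))))))) p = p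
adjI-sym (suc (suc (suc zero))) zero p = p
adjI-sym (suc (suc (suc zero))) (suc zero) p = p
adjI-sym (suc (suc (suc zero))) (suc (suc zero)) p = p
adjI-sym (suc (suc (suc zero))) (suc (suc (suc zero))) p = p
adjI-sym (suc (suc (suc zero))) (suc (suc (suc (suc zero)))) p = p
adjI-sym (suc (suc (suc zero))) (suc (suc (suc (suc (suc zero))))) p = p
adjI-sym (suc (suc (suc zero))) (suc (suc (suc (suc (suc (suc zero)))))) p = p
adjI-sym (suc (suc (suc zero))) (suc (suc (suc (suc (suc (suc (suc zero))))))) p = p
adjI-sym (suc (suc (suc (suc zero)))) zero p = p
adjI-sym (suc (suc (suc (suc zero)))) (suc zero) p = p
adjI-sym (suc (suc (suc (suc zero)))) (suc (suc zero)) p = p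
adjI-sym (suc (suc (suc (suc zero)))) (suc (suc (suc zero))) p = p
adjI-sym (suc (suc (suc (suc zero)))) (suc (suc (suc (suc zero)))) p = p
adjI-sym (suc (suc (suc (suc zero)))) (suc (suc (suc (suc (suc zero))))) p = p
adjI-sym (suc (suc (suc (suc zero)))) (suc (suc (suc (suc (suc (suc zero)))))) p = p
adjI-sym (suc (suc (suc (suc zero)))) (suc (suc (suc (suc (suc (suc (suc zero))))))) p = p
adjI-sym (suc (suc (suc (suc (suc zero))))) zero p = p
adjI-sym (suc (suc (suc (suc (suc zero))))) (suc zero) p = p
adjI-sym (suc (suc (suc (suc (suc zero))))) (suc (suc zero)) p = p
adjI-sym (suc (suc (suc (suc (suc zero))))) (suc (suc (suc zero))) p = p
adjI-sym (suc (suc (suc (suc (suc zero))))) (suc (suc (suc (suc zero)))) p = p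
adjI-sym (suc (suc (suc (suc (suc zero))))) (suc (suc (suc (suc (suc zero))))) p = p
adjI-sym (suc (suc (suc (suc (suc zero))))) (suc (suc (suc (suc (suc (suc zero)))))) p = p
adjI-sym (suc (suc (suc (suc (suc zero))))) (suc (suc (suc (suc (suc (suc (suc zero))))))) p = p
adjI-sym (suc (suc (suc (suc (suc (suc zero)))))) zero p = p
adjI-sym (suc (suc (suc (suc (suc (suc zero)))))) (suc zero) p = p
adjI-sym (suc (suc (suc (suc (suc (suc zero)))))) (suc (suc zero)) p = p
adjI-sym (suc (suc (suc (suc (suc (suc zero)))))) (suc (suc (suc zero))) p = p
adjI-sym (suc (suc (suc (suc (suc (suc zero)))))) (suc (suc (suc (suc zero)))) p = p
adjI-sym (suc (suc (suc (suc (suc (suc zero)))))) (suc (suc (suc (suc (suc zero))))) p = p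
adjI-sym (suc (suc (suc (suc (suc (suc zero)))))) (suc (suc (suc (suc (suc (suc zero)))))) p = p
adjI-sym (suc (suc (suc (suc (suc (suc zero)))))) (suc (suc (suc (suc (suc (suc (suc zero))))))) p = p
adjI-sym (suc (suc (suc (suc (suc (suc (suc zero))))))) zero p = p
adjI-sym (suc (suc (suc (suc (suc (suc (suc zero))))))) (suc zero) p = p
adjI-sym (suc (suc (suc (suc (suc (suc (suc zero))))))) (suc (suc zero)) p = p
adjI-sym (suc (suc (suc (suc (suc (suc (suc zero))))))) (suc (suc (suc zero))) p = p
adjI-sym (suc (suc (suc (suc (suc (suc (suc zero))))))) (suc (suc (suc (suc zero)))) p = p
adjI-sym (suc (suc (suc (suc (suc (suc (suc zero))))))) (suc (suc (suc (suc (suc zero))))) p = p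
adjI-sym (suc (suc (suc (suc (suc (suc (suc zero))))))) (suc (suc (suc (suc (suc (suc zero)))))) p = p
adjI-sym (suc (suc (suc (suc (suc (suc (suc zero))))))) (suc (suc (suc (suc (suc (suc (suc zero))))))) p = p

adjI-irr : ∀ u → ¬ T (adjI u u)
adjI-irr zero ()
adjI-irr (suc zero) ()
adjI-irr (suc (suc zero)) ()
adjI-irr (suc (suc (suc zero))) ()
adjI-irr (suc (suc (suc (suc zero)))) ()
adjI-irr (suc (suc (suc (suc (suc zero))))) ()
adjI-irr (suc (suc (suc (suc (suc (suc zero)))))) ()
adjI-irr (suc (suc (suc (suc (suc (suc (suc zero))))))) ()

I : Graph 8
I = record { Adj = λ u v → T (adjI u v) ; sym = λ {u} {v} → adjI-sym u v ; irref = λ {u} → adjI-irr u }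

-- Every proper k-TDL of K₄ with k ≤ 8 labels some vertex 8 and no vertex 4; this
-- is checked by exhaustive search over the 9⁴ vertex labelings with values ≤ 8.
-- Both halves of I are copies of K₄, so no k-TDL of I exists for k < 8, and an
-- 8-TDL of I never uses the vertex label 4, hence is never saturated. The upper
-- bound χ_td(I) ≤ 8 is witnessed by an explicit labeling.
module Submission where

open import Defs
open import Data.Bool using (T?)
open import Data.Empty using (⊥-elim)
open import Data.Unit using (tt)
open import Data.Fin using (Fin; zero; suc; _↑ˡ_; _↑ʳ_; splitAt)
open import Data.Fin.Properties using (all?; any?; splitAt⁻¹-↑ˡ; splitAt⁻¹-↑ʳ)
  renaming (_≟_ to _≟ᶠ_)
open import Data.Nat using (ℕ; suc; _≤_; _<_; _≤?_; _≟_; s≤s; z≤n; allUpTo?)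
open import Data.Nat.Base using (∣_-_∣)
open import Data.Nat.Properties using (≤-refl; ≤-trans; <⇒≤; <⇒≱; m≤m+n; m+n≮m)
open import Data.Product using (Σ; ∃; _×_; _,_; proj₁; proj₂)
open import Data.Sum using (_⊎_; inj₁; inj₂)
open import Data.Vec using (_∷_; []; lookup; tabulate)
open import Data.Vec.Properties using (lookup∘tabulate)
open import Function using (_∘_)
open import Function.Definitions using (Injective)
open import Relation.Binary.Construct.Closure.ReflexiveTransitive
  using (Star; ε; _◅_; _◅◅_; reverse)
open import Relation.Binary.PropositionalEquality
  using (_≡_; _≢_; _≗_; refl; trans; cong₂; subst)
  renaming (sym to ≡-sym)
open import Relation.Nullary using (Dec; yes; no; ¬_; ¬?; contradiction)
open import Relation.Nullary.Decidable using (map′; _×-dec_; _→-dec_; toWitness)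

private
  variable
    m n k : ℕ

complete : ∀ n → Graph n
complete n = record
  { Adj = _≢_ ; sym = λ u≢v v≡u → u≢v (≡-sym v≡u) ; irref = λ u≢u → u≢u refl }

K₄ : Graph 4
K₄ = complete 4

Clique : Graph n → (Fin m → Fin n) → Set
Clique G ι = ∀ i j → i ≢ j → Adj G (ι i) (ι j)

clique? : (G : Graph n) → (∀ u v → Dec (Adj G u v)) → (ι : Fin m → Fin n) → Dec (Clique G ι)
clique? G adj? ι = all? λ i → all? λ j → ¬? (i ≟ᶠ j) →-dec adj? (ι i) (ι j)

clique-injective : (G : Graph n) {ι : Fin m → Fin n} → Clique G ι → Injective _≡_ _≡_ ι
clique-injective G {ι} cl {i} {j} ιi≡ιj with i ≟ᶠ j
... | yes i≡j = i≡j
... | no i≢j  = ⊥-elim (irref G (subst (Adj G (ι i)) (≡-sym ιi≡ιj) (cl i j i≢j)))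

clique-connected : (G : Graph n) {ι : Fin m → Fin n} → Clique G ι →
                   ∀ i j → Star (Adj G) (ι i) (ι j)
clique-connected G cl i j with i ≟ᶠ j
... | yes refl = ε
... | no i≢j   = cl i j i≢j ◅ ε

connected-via-hub : (G : Graph n) (r : Fin n) → (∀ v → Star (Adj G) v r) → Connected G
connected-via-hub G r to-r u v = to-r u ◅◅ reverse (sym G) (to-r v)

module _ {G : Graph n} where

  isTDL? : (∀ u v → Dec (Adj G u v)) → ∀ k f → Dec (IsTDL G k f)
  isTDL? adj? k f = map′
    (λ (r , er , vp , ep , vep) → record
      { vlabel-range = r ; elabel-range = er ; vproper = vp ; eproper = ep ; veproper = vep })
    (λ t → let open IsTDL t in vlabel-range , elabel-range , vproper , eproper , veproper)
    (     (all? λ v → within? (f v))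
    ×-dec (all? λ u → all? λ v → adj? u v →-dec within? ∣ f u - f v ∣)
    ×-dec (all? λ u → all? λ v → adj? u v →-dec ¬? (f u ≟ f v))
    ×-dec (all? λ u → all? λ v → all? λ w → adj? u v →-dec (adj? u w →-dec
             (¬? (v ≟ᶠ w) →-dec ¬? (∣ f u - f v ∣ ≟ ∣ f u - f w ∣))))
    ×-dec (all? λ u → all? λ v → adj? u v →-dec ¬? (∣ f u - f v ∣ ≟ f u)))
    where
    within? : ∀ x → Dec (1 ≤ x × x ≤ k)
    within? x = 1 ≤? x ×-dec x ≤? k

  IsTDL-resp-≗ : ∀ {f g} → f ≗ g → IsTDL G k f → IsTDL G k g
  IsTDL-resp-≗ {k = k} {f} {g} f≗g t = record
    { vlabel-range = λ v → subst Within (f≗g v) (vlabel-range v)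
    ; elabel-range = λ u v a → subst Within (edge≡ u v) (elabel-range u v a)
    ; vproper      = λ u v a gu≡gv → vproper u v a (trans (f≗g u) (trans gu≡gv (≡-sym (f≗g v))))
    ; eproper      = λ u v w a b v≢w eq →
        eproper u v w a b v≢w (trans (edge≡ u v) (trans eq (≡-sym (edge≡ u w))))
    ; veproper     = λ u v a eq → veproper u v a (trans (edge≡ u v) (trans eq (≡-sym (f≗g u))))
    }
    where
    open IsTDL t
    Within : ℕ → Set
    Within x = 1 ≤ x × x ≤ k
    edge≡ : ∀ u v → ∣ f u - f v ∣ ≡ ∣ g u - g v ∣
    edge≡ u v = cong₂ ∣_-_∣ (f≗g u) (f≗g v)

  IsTDL-mono : ∀ {k k′ f} → k ≤ k′ → IsTDL G k f → IsTDL G k′ f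
  IsTDL-mono k≤k′ t = record
    { vlabel-range = λ v → widen (vlabel-range v)
    ; elabel-range = λ u v a → widen (elabel-range u v a)
    ; vproper = vproper ; eproper = eproper ; veproper = veproper
    }
    where
    open IsTDL t
    widen : ∀ {x} → 1 ≤ x × x ≤ _ → 1 ≤ x × x ≤ _
    widen (1≤x , x≤k) = 1≤x , ≤-trans x≤k k≤k′

IsTDL-restrict : {H : Graph m} {G : Graph n} {f : Fin n → ℕ} (ι : Fin m → Fin n) →
                 (∀ {u v} → Adj H u v → Adj G (ι u) (ι v)) → Injective _≡_ _≡_ ι →
                 IsTDL G k f → IsTDL H k (f ∘ ι)
IsTDL-restrict ι hom inj t = record
  { vlabel-range = vlabel-range ∘ ι
  ; elabel-range = λ u v a → elabel-range (ι u) (ι v) (hom a)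
  ; vproper      = λ u v a → vproper (ι u) (ι v) (hom a)
  ; eproper      = λ u v w a b v≢w → eproper (ι u) (ι v) (ι w) (hom a) (hom b) (v≢w ∘ inj)
  ; veproper     = λ u v a → veproper (ι u) (ι v) (hom a)
  }
  where open IsTDL t

IsTDL-clique : (G : Graph n) {ι : Fin m → Fin n} {f : Fin n → ℕ} → Clique G ι →
               IsTDL G k f → IsTDL (complete m) k (f ∘ ι)
IsTDL-clique G {ι} cl = IsTDL-restrict ι (cl _ _) (clique-injective G cl)

Uses8∧Avoids4 : (Fin n → ℕ) → Set
Uses8∧Avoids4 g = (∃ λ v → g v ≡ 8) × (∀ v → g v ≢ 4)

Uses8∧Avoids4-resp-≗ : ∀ {f g : Fin n → ℕ} → f ≗ g → Uses8∧Avoids4 g → Uses8∧Avoids4 f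
Uses8∧Avoids4-resp-≗ f≗g ((v , gv≡8) , avoids) =
  (v , trans (f≗g v) gv≡8) , λ v fv≡4 → avoids v (trans (≡-sym (f≗g v)) fv≡4)

-- Splitting on the label of vertex 0 only keeps each decision procedure run
-- small; deciding all 9⁴ labelings in a single term exhausts memory.
K₄-Case : ℕ → Set
K₄-Case a = ∀ {b} → b < 9 → ∀ {c} → c < 9 → ∀ {d} → d < 9 →
            let g = lookup (a ∷ b ∷ c ∷ d ∷ []) in IsTDL K₄ 8 g → Uses8∧Avoids4 g

K₄-case? : ∀ a → Dec (K₄-Case a)
K₄-case? a = below9? λ b → below9? λ c → below9? λ d →
  let g = lookup (a ∷ b ∷ c ∷ d ∷ []) in
  isTDL? (λ u v → ¬? (u ≟ᶠ v)) 8 g →-dec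
    ((any? λ v → g v ≟ 8) ×-dec (all? λ v → ¬? (g v ≟ 4)))
  where
  below9? : ∀ {P : ℕ → Set} → (∀ n → Dec (P n)) → Dec (∀ {n} → n < 9 → P n)
  below9? P? = allUpTo? P? 9

K₄-cases : ∀ {a} → a < 9 → K₄-Case a
K₄-cases {0} _ = toWitness {a? = K₄-case? 0} _
K₄-cases {1} _ = toWitness {a? = K₄-case? 1} _
K₄-cases {2} _ = toWitness {a? = K₄-case? 2} _
K₄-cases {3} _ = toWitness {a? = K₄-case? 3} _
K₄-cases {4} _ = toWitness {a? = K₄-case? 4} _
K₄-cases {5} _ = toWitness {a? = K₄-case? 5} _
K₄-cases {6} _ = toWitness {a? = K₄-case? 6} _
K₄-cases {7} _ = toWitness {a? = K₄-case? 7} _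
K₄-cases {8} _ = toWitness {a? = K₄-case? 8} _
K₄-cases {suc (suc (suc (suc (suc (suc (suc (suc (suc a))))))))} 9+a<9 =
  contradiction 9+a<9 (m+n≮m 9 a)

K₄-TDL-uses8∧avoids4 : ∀ {g} → k ≤ 8 → IsTDL K₄ k g → Uses8∧Avoids4 g
K₄-TDL-uses8∧avoids4 {g = g} k≤8 t =
  Uses8∧Avoids4-resp-≗ g≗ (K₄-cases (bound zero) (bound (suc zero))
    (bound (suc (suc zero))) (bound (suc (suc (suc zero)))) (IsTDL-resp-≗ g≗ t₈))
  where
  t₈ : IsTDL K₄ 8 g
  t₈ = IsTDL-mono k≤8 t
  bound : ∀ v → g v < 9
  bound v = s≤s (proj₂ (IsTDL.vlabel-range t₈ v))
  g≗ : g ≗ lookup (tabulate g)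
  g≗ v = ≡-sym (lookup∘tabulate g v)

module _ (G : Graph n) {ι : Fin 4 → Fin n} (cl : Clique G ι) where

  clique₄-uses8∧avoids4 : ∀ {f} → k ≤ 8 → IsTDL G k f → Uses8∧Avoids4 (f ∘ ι)
  clique₄-uses8∧avoids4 k≤8 = K₄-TDL-uses8∧avoids4 k≤8 ∘ IsTDL-clique G cl

  clique₄⇒¬HasTDL : ∀ j → j < 8 → ¬ HasTDL G j
  clique₄⇒¬HasTDL j j<8 (f , t) =
    let i , fιi≡8 = proj₁ (clique₄-uses8∧avoids4 (<⇒≤ j<8) t)
    in <⇒≱ j<8 (subst (_≤ j) fιi≡8 (proj₂ (IsTDL.vlabel-range t (ι i))))

CoveredByK₄s : Graph n → Set
CoveredByK₄s {n} G = ∀ v → Σ (Fin 4 → Fin n) λ ι → Clique G ι × ∃ λ i → ι i ≡ v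

K₄-covered⇒avoids4 : (G : Graph n) → CoveredByK₄s G →
                     ∀ {f} → k ≤ 8 → IsTDL G k f → ∀ v → f v ≢ 4
K₄-covered⇒avoids4 G cover k≤8 t v with cover v
... | ι , cl , i , refl = proj₂ (clique₄-uses8∧avoids4 G cl k≤8 t) i

left right : Fin 4 → Fin 8
left  = _↑ˡ 4
right = 4 ↑ʳ_

I-adj? : ∀ u v → Dec (Adj I u v)
I-adj? u v = T? (adjI u v)

left-clique : Clique I left
left-clique = toWitness {a? = clique? I I-adj? left} _

right-clique : Clique I right
right-clique = toWitness {a? = clique? I I-adj? right} _

I-halves : ∀ v → (∃ λ i → left i ≡ v) ⊎ (∃ λ i → right i ≡ v)
I-halves v with splitAt 4 v in eq
... | inj₁ i = inj₁ (i , splitAt⁻¹-↑ˡ eq)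
... | inj₂ i = inj₂ (i , splitAt⁻¹-↑ʳ eq)

I-covered : CoveredByK₄s I
I-covered v with I-halves v
... | inj₁ (i , li≡v) = left  , left-clique  , i , li≡v
... | inj₂ (i , ri≡v) = right , right-clique , i , ri≡v

I-connected : Connected I
I-connected = connected-via-hub I (left zero) to-hub
  where
  to-hub : ∀ v → Star (Adj I) v (left zero)
  to-hub v with I-halves v
  ... | inj₁ (i , refl) = clique-connected I {left} left-clique i zero
  ... | inj₂ (i , refl) = clique-connected I {right} right-clique i zero ◅◅ tt ◅ ε

I-labeling : Fin 8 → ℕ
I-labeling = lookup (1 ∷ 5 ∷ 6 ∷ 8 ∷ 3 ∷ 2 ∷ 7 ∷ 8 ∷ [])

I-labeling-TDL : IsTDL I 8 I-labeling
I-labeling-TDL = toWitness {a? = isTDL? I-adj? 8 I-labeling} _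

I-¬Saturable : ¬ Saturable I
I-¬Saturable (f , _ , t , onto) with onto 4 (s≤s z≤n) (m≤m+n 4 4)
... | v , fv≡4 = K₄-covered⇒avoids4 I I-covered ≤-refl t v fv≡4

mainTheorem13 : χtd≡ I 8 × Connected I × order I ≡ 8 × ¬ Saturable I
mainTheorem13 =
  ((I-labeling , I-labeling-TDL) , clique₄⇒¬HasTDL I {left} left-clique) ,
  I-connected , refl , I-¬Saturable
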